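{- Let $P(X)=X^4+c_3X^3+c_2X^2+c_1X+c_0\in\mathbb{Z}[X]$ be monic and irreducible with root $r_1$. With the notation of the context, let $a_0,a_1,a_2,a_3\in\mathbb{Z}$ and $p$ a prime be such that $\gcd(q(a_1,a_2,a_3),q_3(a_1,a_2,a_3))=1$, $q(a_1,a_2,a_3)$ is squarefree and $p\mid\gcd(q(a_1,a_2,a_3),B_{14}(a_0,a_1,a_2,a_3))$. Then, with $\alpha=a_0+a_1r_1+a_2r_1^2+a_3r_1^3$, \[p\mid N_P(\alpha)\iff p\mid B_{13}(a_0,a_1,a_2,a_3).\]
   Context: $M_\alpha$ is the $4\times4$ matrix of multiplication by $\alpha$ on $\mathbb{Q}(r_1)$ in the basis $1,r_1,r_1^2,r_1^3$ (viewed with $a_i$ as indeterminates, entries in $\mathbb{Z}[a_0,\dots,a_3]$), $N_P(\alpha)=\det M_\alpha$ (the norm of $\alpha$ from $\mathbb{Q}(r_1)$ to $\mathbb{Q}$), and $B_{ij}$ is $(-1)^{i+j}$ times the determinant of $M_\alpha$ with row $i$ and column $j$ deleted. $q_3=a_2^2-a_1a_3-c_3a_2a_3+c_2a_3^2$; $R_0$ is the resultant of $B_{13}$ and $B_{14}$ with respect to $a_0$, and $q:=R_0/q_3\in\mathbb{Z}[a_1,a_2,a_3]$. -}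

module Defs where

open import Data.Nat as ℕ using (ℕ; zero; suc)
open import Data.Integer as ℤ using (ℤ; +_; _+_; _*_; -_; ∣_∣)
open import Data.Fin as Fin using (Fin; zero; suc; punchIn; toℕ)
open import Data.List using (List; []; _∷_; map)
open import Data.Nat.Divisibility as ℕ using (_∣_)
open import Data.Bool using (Bool; true; false; if_then_else_; _∧_)
open import Data.Product using (Σ; ∃; _×_; _,_)
open import Relation.Binary.PropositionalEquality using (_≡_; _≢_)
open import Relation.Nullary using (¬_)

module Det {A : Set} (_⊞_ : A → A → A) (_⊠_ : A → A → A)
           (⊟_ : A → A) (𝟘 𝟙 : A) where

  signed : ℕ → A → A
  signed zero    x = x
  signed (suc k) x = ⊟ (signed k x)

  minor : ∀ {n} → Fin (suc n) → Fin (suc n)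
        → (Fin (suc n) → Fin (suc n) → A) → Fin n → Fin n → A
  minor i j m k l = m (punchIn i k) (punchIn j l)

  det : ∀ n → (Fin n → Fin n → A) → A
  det zero    m = 𝟙
  det (suc n) m = go (suc n) (λ j → j)
    where
      go : ∀ k → (Fin k → Fin (suc n)) → A
      go zero    f = 𝟘
      go (suc k) f = signed (toℕ (f zero))
                       (m zero (f zero) ⊠ det n (minor zero (f zero) m))
                     ⊞ go k (λ x → f (suc x))

  cofactor : ∀ n → Fin (suc n) → Fin (suc n)
           → (Fin (suc n) → Fin (suc n) → A) → A
  cofactor n i j m = signed (toℕ i ℕ.+ toℕ j) (det n (minor i j m))

-- Univariate polynomials over ℤ as coefficient lists (constant term first)

Poly : Set
Poly = List ℤ

_⊕_ : Poly → Poly → Poly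
[]       ⊕ q        = q
(x ∷ p)  ⊕ []       = x ∷ p
(x ∷ p)  ⊕ (y ∷ q)  = (x + y) ∷ (p ⊕ q)

⊖_ : Poly → Poly
⊖ p = map -_ p

_⊗_ : Poly → Poly → Poly
[]      ⊗ q = []
(x ∷ p) ⊗ q = map (x *_) q ⊕ (+ 0 ∷ (p ⊗ q))

const : ℤ → Poly
const x = x ∷ []

var : Poly
var = + 0 ∷ + 1 ∷ []

coeff : Poly → ℕ → ℤ
coeff []      k       = + 0
coeff (x ∷ p) zero    = x
coeff (x ∷ p) (suc k) = coeff p k

NonConstant : Poly → Set
NonConstant f = Σ ℕ λ k → (k ℕ.≥ 1) × (coeff f k ≢ + 0)

-- Irreducibility in ℤ[X] of a primitive polynomial (e.g. a monic one):
-- it is not a product of two non-constant integer polynomials.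
-- (For primitive P the only constant divisors are the units ±1.)
IrreducibleℤX : Poly → Set
IrreducibleℤX P = ¬ (Σ Poly λ f → Σ Poly λ g →
  NonConstant f × NonConstant g × (∀ k → coeff P k ≡ coeff (f ⊗ g) k))

quartic : ℤ → ℤ → ℤ → ℤ → Poly
quartic c0 c1 c2 c3 = c0 ∷ c1 ∷ c2 ∷ c3 ∷ + 1 ∷ []

-- Multiplication by α = a0 + a1 r + a2 r^2 + a3 r^3 on ℚ(r), r a root
-- of P, in the basis 1, r, r^2, r^3.  Generic in the coefficient type.

module MulMatrix {A : Set} (_⊞_ : A → A → A) (_⊠_ : A → A → A)
                 (⊟_ : A → A) (𝟘 : A) where

  Vec4 : Set
  Vec4 = Fin 4 → A

  -- coordinates of r·x given coordinates of x, using
  -- r^4 = -c0 - c1 r - c2 r^2 - c3 r^3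
  mulR : (c0 c1 c2 c3 : A) → Vec4 → Vec4
  mulR c0 c1 c2 c3 v zero                   = ⊟ (c0 ⊠ v (suc (suc (suc zero))))
  mulR c0 c1 c2 c3 v (suc zero)             = v zero ⊞ (⊟ (c1 ⊠ v (suc (suc (suc zero)))))
  mulR c0 c1 c2 c3 v (suc (suc zero))       = v (suc zero) ⊞ (⊟ (c2 ⊠ v (suc (suc (suc zero)))))
  mulR c0 c1 c2 c3 v (suc (suc (suc zero))) = v (suc (suc zero)) ⊞ (⊟ (c3 ⊠ v (suc (suc (suc zero)))))

  column : (c0 c1 c2 c3 : A) → Vec4 → ℕ → Vec4
  column c0 c1 c2 c3 α zero    = α
  column c0 c1 c2 c3 α (suc j) = mulR c0 c1 c2 c3 (column c0 c1 c2 c3 α j)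

  -- M_α : entry (i , j) = i-th coordinate of α · r^j (columns are the
  -- images of the basis vectors)
  Mα : (c0 c1 c2 c3 a0 a1 a2 a3 : A) → Fin 4 → Fin 4 → A
  Mα c0 c1 c2 c3 a0 a1 a2 a3 i j = column c0 c1 c2 c3 α (toℕ j) i
    where
      α : Vec4
      α zero                   = a0
      α (suc zero)             = a1
      α (suc (suc zero))       = a2
      α (suc (suc (suc zero))) = a3

private
  module Zdet = Det _+_ _*_ -_ (+ 0) (+ 1)
  module Zmul = MulMatrix _+_ _*_ -_ (+ 0)
  module Pdet = Det _⊕_ _⊗_ ⊖_ [] (const (+ 1))
  module Pmul = MulMatrix _⊕_ _⊗_ ⊖_ []

#0 #1 #2 #3 : Fin 4
#0 = zero
#1 = suc zero
#2 = suc (suc zero)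
#3 = suc (suc (suc zero))

NP : (c0 c1 c2 c3 a0 a1 a2 a3 : ℤ) → ℤ
NP c0 c1 c2 c3 a0 a1 a2 a3 = Zdet.det 4 (Zmul.Mα c0 c1 c2 c3 a0 a1 a2 a3)

-- B_ij (1-indexed in the paper) = cofactor at (i-1, j-1)
B : (i j : Fin 4) → (c0 c1 c2 c3 a0 a1 a2 a3 : ℤ) → ℤ
B i j c0 c1 c2 c3 a0 a1 a2 a3 = Zdet.cofactor 3 i j (Zmul.Mα c0 c1 c2 c3 a0 a1 a2 a3)

B13 B14 : (c0 c1 c2 c3 a0 a1 a2 a3 : ℤ) → ℤ
B13 = B #0 #2
B14 = B #0 #3

q3 : (c0 c1 c2 c3 a1 a2 a3 : ℤ) → ℤ
q3 c0 c1 c2 c3 a1 a2 a3 =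
  a2 * a2 + (- (a1 * a3)) + (- (c3 * a2 * a3)) + c2 * a3 * a3

-- B_ij as a polynomial in a0 (a1, a2, a3 specialised to integers)
Bpoly : (i j : Fin 4) → (c0 c1 c2 c3 a1 a2 a3 : ℤ) → Poly
Bpoly i j c0 c1 c2 c3 a1 a2 a3 =
  Pdet.cofactor 3 i j
    (Pmul.Mα (const c0) (const c1) (const c2) (const c3)
             var (const a1) (const a2) (const a3))

-- Sylvester matrix of f (formal degree m) and g (formal degree n),
-- size (n + m); rows 0..n-1 hold shifts of f, rows n..n+m-1 shifts of g.
sylvester : (m n : ℕ) → Poly → Poly → Fin (n ℕ.+ m) → Fin (n ℕ.+ m) → ℤ
sylvester m n f g i j =
  if toℕ i ℕ.<ᵇ n
  then entry f m (toℕ i) (toℕ j)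
  else entry g n (toℕ i ℕ.∸ n) (toℕ j)
  where
    entry : Poly → ℕ → ℕ → ℕ → ℤ
    entry h d r c =
      if (r ℕ.≤ᵇ c) ∧ ((c ℕ.∸ r) ℕ.≤ᵇ d)
      then coeff h (d ℕ.∸ (c ℕ.∸ r))
      else + 0

resultant : (m n : ℕ) → Poly → Poly → ℤ
resultant m n f g = Zdet.det (n ℕ.+ m) (sylvester m n f g)

-- R_0(a1,a2,a3) = Res_{a0}(B13, B14); both have formal degree 2 in a0
-- (leading coefficients ±a2 and ±a3 respectively).
R0 : (c0 c1 c2 c3 a1 a2 a3 : ℤ) → ℤ
R0 c0 c1 c2 c3 a1 a2 a3 =
  resultant 2 2 (Bpoly #0 #2 c0 c1 c2 c3 a1 a2 a3)
                (Bpoly #0 #3 c0 c1 c2 c3 a1 a2 a3)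

-- Squarefree integers (0 is not squarefree)
SquareFree : ℤ → Set
SquareFree x = ∀ (d : ℕ) → (d ℕ.* d) ℕ.∣ ∣ x ∣ → d ≡ 1

-- Jacobi's theorem on minors of the adjugate gives q₃ · N_P(α) =
-- B₁₃ B₂₄ − B₁₄ B₂₃, where q₃ is the complementary minor (rows 3,4,
-- columns 1,2) of M_α; moreover B₂₄ = B₁₃ − c₃ B₁₄ for the multiplication
-- matrix M_α.  Since p divides q and B₁₄ while gcd(q, q₃) = 1, reducing
-- modulo p gives q₃ N_P(α) ≡ B₁₃² with q₃ a unit, so p ∣ N_P(α) ⇔ p ∣ B₁₃.
module Submission where

open import Defs hiding (_⊕_; ⊖_; _⊗_)
open import Data.Nat using (ℕ)
open import Data.Nat.Primality using (Prime)
open import Data.Integer using (ℤ; +_; _*_)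
open import Data.Integer.Divisibility using (_∣_)
open import Data.Integer.GCD using (gcd)
open import Relation.Binary.PropositionalEquality using (_≡_)
open import Function.Bundles using (_⇔_)

open import Data.Nat.Base using (nonTrivial⇒≢1)
open import Data.Nat.Divisibility using (∣1⇒≡1; ∣-trans) renaming (_∣_ to _ℕ∣_)
open import Data.Nat.Primality using (euclidsLemma; prime⇒nonTrivial)
open import Data.Integer using (_+_; -_; _-_; ∣_∣)
open import Data.Integer.Properties using (abs-*)
open import Data.Integer.GCD using (gcd[i,j]∣i; gcd[i,j]∣j; gcd-greatest)
import Data.Integer.Divisibility.Signed as Signed
open import Data.Integer.Tactic.RingSolver using (ring)
open import Tactic.RingSolver.NonReflective ring
open import Data.Fin using (Fin)
open import Data.Vec using (Vec; []; _∷_; lookup)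
open import Data.Sum using (_⊎_; [_,_]′)
open import Data.Empty using (⊥-elim)
open import Function.Base using (id)
open import Function.Bundles using (mk⇔; module Equivalence)
open import Function.Construct.Composition using (_⇔-∘_)
open import Function.Construct.Symmetry using (⇔-sym)
open import Relation.Binary.PropositionalEquality using (refl; sym; cong; subst; module ≡-Reasoning)
open import Relation.Nullary using (¬_)

module _ {k : ℕ} where

  ∣n⇒∣m*n : ∀ m n → + k ∣ n → + k ∣ m * n
  ∣n⇒∣m*n m n k∣n = Signed.∣⇒∣ᵤ {+ k} {m * n} (Signed.∣n⇒∣m*n m (Signed.∣ᵤ⇒∣ {+ k} {n} k∣n))

  ∣m⇒∣m*n : ∀ m n → + k ∣ m → + k ∣ m * n
  ∣m⇒∣m*n m n k∣m = Signed.∣⇒∣ᵤ {+ k} {m * n} (Signed.∣m⇒∣m*n n (Signed.∣ᵤ⇒∣ {+ k} {m} k∣m))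

  ∣n⇒∣m-n⇔∣m : ∀ m n → + k ∣ n → ((+ k ∣ m - n) ⇔ (+ k ∣ m))
  ∣n⇒∣m-n⇔∣m m n k∣n = mk⇔
    (λ k∣m-n → Signed.∣⇒∣ᵤ {+ k} {m}
      (Signed.∣m+n∣n⇒∣m {+ k} {m} (Signed.∣ᵤ⇒∣ {+ k} {m - n} k∣m-n) (Signed.∣m⇒∣-m {+ k} {n} k∣nˢ)))
    (λ k∣m → Signed.∣⇒∣ᵤ {+ k} {m - n}
      (Signed.∣m∣n⇒∣m-n {+ k} {m} {n} (Signed.∣ᵤ⇒∣ {+ k} {m} k∣m) k∣nˢ))
    where
    k∣nˢ : + k Signed.∣ n
    k∣nˢ = Signed.∣ᵤ⇒∣ {+ k} {n} k∣n

module _ {p : ℕ} (p-prime : Prime p) where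

  prime∣m*n⇒∣m⊎∣n : ∀ m n → + p ∣ m * n → (+ p ∣ m) ⊎ (+ p ∣ n)
  prime∣m*n⇒∣m⊎∣n m n p∣mn = euclidsLemma ∣ m ∣ ∣ n ∣ p-prime (subst (p ℕ∣_) (abs-* m n) p∣mn)

  prime∤m⇒∣m*n⇔∣n : ∀ m n → ¬ + p ∣ m → ((+ p ∣ m * n) ⇔ (+ p ∣ n))
  prime∤m⇒∣m*n⇔∣n m n p∤m = mk⇔
    (λ p∣mn → [ (λ p∣m → ⊥-elim (p∤m p∣m)) , id ]′ (prime∣m*n⇒∣m⊎∣n m n p∣mn))
    (∣n⇒∣m*n m n)

  prime∣n⇒∣m*[m-c*n]⇔∣m : ∀ m n c → + p ∣ n → ((+ p ∣ m * (m - c * n)) ⇔ (+ p ∣ m))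
  prime∣n⇒∣m*[m-c*n]⇔∣m m n c p∣n = mk⇔
    (λ p∣m[m-cn] → [ id , Equivalence.to (∣n⇒∣m-n⇔∣m m (c * n) (∣n⇒∣m*n c n p∣n)) ]′
                     (prime∣m*n⇒∣m⊎∣n m (m - c * n) p∣m[m-cn]))
    (∣m⇒∣m*n m (m - c * n))

  gcd≡1⇒prime∣m⇒∤n : ∀ m n → gcd m n ≡ + 1 → + p ∣ m → ¬ + p ∣ n
  gcd≡1⇒prime∣m⇒∤n m n gcd≡1 p∣m p∣n =
    nonTrivial⇒≢1 {{prime⇒nonTrivial p-prime}}
      (∣1⇒≡1 (subst (+ p ∣_) gcd≡1 (gcd-greatest {m} {n} {+ p} p∣m p∣n)))

module ℤDet = Det _+_ _*_ -_ (+ 0) (+ 1)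
module ℤMul = MulMatrix _+_ _*_ -_ (+ 0)
module Det₁₆ = Det {Expr ℤ 16} _⊕_ _⊗_ ⊝_ (Κ (+ 0)) (Κ (+ 1))
module Det₈ = Det {Expr ℤ 8} _⊕_ _⊗_ ⊝_ (Κ (+ 0)) (Κ (+ 1))
module Mul₈ = MulMatrix {Expr ℤ 8} _⊕_ _⊗_ ⊝_ (Κ (+ 0))

fromRows : {A : Set} → Vec (Vec A 4) 4 → Fin 4 → Fin 4 → A
fromRows rows i j = lookup (lookup rows i) j

lowerLeftMinor : (Fin 4 → Fin 4 → ℤ) → ℤ
lowerLeftMinor m = m #2 #0 * m #3 #1 - m #2 #1 * m #3 #0

-- Jacobi's theorem on minors of the adjugate, for rows 1, 2 and columns 3, 4.
lowerLeftMinor*det≡det[upperRightCofactors] : ∀ (m : Fin 4 → Fin 4 → ℤ) →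
  lowerLeftMinor m * ℤDet.det 4 m ≡
  ℤDet.cofactor 3 #0 #2 m * ℤDet.cofactor 3 #1 #3 m - ℤDet.cofactor 3 #0 #3 m * ℤDet.cofactor 3 #1 #2 m
lowerLeftMinor*det≡det[upperRightCofactors] m =
  solve 16
    (λ x₀₀ x₀₁ x₀₂ x₀₃ x₁₀ x₁₁ x₁₂ x₁₃ x₂₀ x₂₁ x₂₂ x₂₃ x₃₀ x₃₁ x₃₂ x₃₃ →
      let M = fromRows ((x₀₀ ∷ x₀₁ ∷ x₀₂ ∷ x₀₃ ∷ []) ∷ (x₁₀ ∷ x₁₁ ∷ x₁₂ ∷ x₁₃ ∷ []) ∷
                        (x₂₀ ∷ x₂₁ ∷ x₂₂ ∷ x₂₃ ∷ []) ∷ (x₃₀ ∷ x₃₁ ∷ x₃₂ ∷ x₃₃ ∷ []) ∷ [])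
      in ((x₂₀ ⊗ x₃₁ ⊕ ⊝ (x₂₁ ⊗ x₃₀)) ⊗ Det₁₆.det 4 M)
         ⊜ (Det₁₆.cofactor 3 #0 #2 M ⊗ Det₁₆.cofactor 3 #1 #3 M
            ⊕ ⊝ (Det₁₆.cofactor 3 #0 #3 M ⊗ Det₁₆.cofactor 3 #1 #2 M)))
    refl
    (m #0 #0) (m #0 #1) (m #0 #2) (m #0 #3) (m #1 #0) (m #1 #1) (m #1 #2) (m #1 #3)
    (m #2 #0) (m #2 #1) (m #2 #2) (m #2 #3) (m #3 #0) (m #3 #1) (m #3 #2) (m #3 #3)

q3≡lowerLeftMinor-Mα : ∀ c0 c1 c2 c3 a0 a1 a2 a3 →
  q3 c0 c1 c2 c3 a1 a2 a3 ≡ lowerLeftMinor (ℤMul.Mα c0 c1 c2 c3 a0 a1 a2 a3)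
q3≡lowerLeftMinor-Mα = solve 8 (λ c0 c1 c2 c3 a0 a1 a2 a3 →
  let M = Mul₈.Mα c0 c1 c2 c3 a0 a1 a2 a3 in
  (a2 ⊗ a2 ⊕ ⊝ (a1 ⊗ a3) ⊕ ⊝ (c3 ⊗ a2 ⊗ a3) ⊕ c2 ⊗ a3 ⊗ a3)
  ⊜ (M #2 #0 ⊗ M #3 #1 ⊕ ⊝ (M #2 #1 ⊗ M #3 #0))) refl

B24≡B13-c3*B14 : ∀ c0 c1 c2 c3 a0 a1 a2 a3 →
  B #1 #3 c0 c1 c2 c3 a0 a1 a2 a3 ≡
  B13 c0 c1 c2 c3 a0 a1 a2 a3 - c3 * B14 c0 c1 c2 c3 a0 a1 a2 a3
B24≡B13-c3*B14 = solve 8 (λ c0 c1 c2 c3 a0 a1 a2 a3 →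
  let M = Mul₈.Mα c0 c1 c2 c3 a0 a1 a2 a3 in
  Det₈.cofactor 3 #1 #3 M ⊜ (Det₈.cofactor 3 #0 #2 M ⊕ ⊝ (c3 ⊗ Det₈.cofactor 3 #0 #3 M))) refl

q3*NP≡B13*[B13-c3*B14]-B14*B23 : ∀ c0 c1 c2 c3 a0 a1 a2 a3 →
  q3 c0 c1 c2 c3 a1 a2 a3 * NP c0 c1 c2 c3 a0 a1 a2 a3 ≡
  B13 c0 c1 c2 c3 a0 a1 a2 a3 * (B13 c0 c1 c2 c3 a0 a1 a2 a3 - c3 * B14 c0 c1 c2 c3 a0 a1 a2 a3)
  - B14 c0 c1 c2 c3 a0 a1 a2 a3 * B #1 #2 c0 c1 c2 c3 a0 a1 a2 a3
q3*NP≡B13*[B13-c3*B14]-B14*B23 c0 c1 c2 c3 a0 a1 a2 a3 = begin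
  q3 c0 c1 c2 c3 a1 a2 a3 * ℤDet.det 4 M  ≡⟨ cong (_* ℤDet.det 4 M) (q3≡lowerLeftMinor-Mα c0 c1 c2 c3 a0 a1 a2 a3) ⟩
  lowerLeftMinor M * ℤDet.det 4 M         ≡⟨ lowerLeftMinor*det≡det[upperRightCofactors] M ⟩
  b #0 #2 * b #1 #3 - b #0 #3 * b #1 #2   ≡⟨ cong (λ b₂₄ → b #0 #2 * b₂₄ - b #0 #3 * b #1 #2)
                                                  (B24≡B13-c3*B14 c0 c1 c2 c3 a0 a1 a2 a3) ⟩
  b #0 #2 * (b #0 #2 - c3 * b #0 #3) - b #0 #3 * b #1 #2  ∎
  where
  open ≡-Reasoning
  M : Fin 4 → Fin 4 → ℤ
  M = ℤMul.Mα c0 c1 c2 c3 a0 a1 a2 a3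
  b : Fin 4 → Fin 4 → ℤ
  b i j = B i j c0 c1 c2 c3 a0 a1 a2 a3

lemma5p17 : (c0 c1 c2 c3 : ℤ) → IrreducibleℤX (quartic c0 c1 c2 c3) →
    (a0 a1 a2 a3 : ℤ) (p : ℕ) → Prime p →
    (q : ℤ) → R0 c0 c1 c2 c3 a1 a2 a3 ≡ q3 c0 c1 c2 c3 a1 a2 a3 * q →
    gcd q (q3 c0 c1 c2 c3 a1 a2 a3) ≡ + 1 →
    SquareFree q →
    (+ p) ∣ gcd q (B14 c0 c1 c2 c3 a0 a1 a2 a3) →
    ((+ p) ∣ NP c0 c1 c2 c3 a0 a1 a2 a3) ⇔ ((+ p) ∣ B13 c0 c1 c2 c3 a0 a1 a2 a3)
lemma5p17 c0 c1 c2 c3 _ a0 a1 a2 a3 p p-prime q _ gcd[q,q₃]≡1 _ p∣gcd[q,B₁₄] =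
  p∣q₃NP⇔p∣B₁₃ ⇔-∘ ⇔-sym (prime∤m⇒∣m*n⇔∣n p-prime q₃ N p∤q₃)
  where
  q₃ N B₁₃ B₁₄ B₂₃ : ℤ
  q₃ = q3 c0 c1 c2 c3 a1 a2 a3
  N = NP c0 c1 c2 c3 a0 a1 a2 a3
  B₁₃ = B13 c0 c1 c2 c3 a0 a1 a2 a3
  B₁₄ = B14 c0 c1 c2 c3 a0 a1 a2 a3
  B₂₃ = B #1 #2 c0 c1 c2 c3 a0 a1 a2 a3
  p∣q : + p ∣ q
  p∣q = ∣-trans p∣gcd[q,B₁₄] (gcd[i,j]∣i q B₁₄)
  p∣B₁₄ : + p ∣ B₁₄
  p∣B₁₄ = ∣-trans p∣gcd[q,B₁₄] (gcd[i,j]∣j q B₁₄)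
  p∤q₃ : ¬ + p ∣ q₃
  p∤q₃ = gcd≡1⇒prime∣m⇒∤n p-prime q q₃ gcd[q,q₃]≡1 p∣q
  p∣q₃NP⇔p∣B₁₃ : (+ p ∣ q₃ * N) ⇔ (+ p ∣ B₁₃)
  p∣q₃NP⇔p∣B₁₃ =
    subst (λ x → (+ p ∣ x) ⇔ (+ p ∣ B₁₃)) (sym (q3*NP≡B13*[B13-c3*B14]-B14*B23 c0 c1 c2 c3 a0 a1 a2 a3))
      (prime∣n⇒∣m*[m-c*n]⇔∣m p-prime B₁₃ B₁₄ c3 p∣B₁₄
        ⇔-∘ ∣n⇒∣m-n⇔∣m (B₁₃ * (B₁₃ - c3 * B₁₄)) (B₁₄ * B₂₃) (∣m⇒∣m*n B₁₄ B₂₃ p∣B₁₄))
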